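{- Let $m,n>1$ be integers, and let $F_{m,n}=P_n+\overline{K}_m$ be the $(m,n)$-fan graph, where $P_n$ is a path of length $n$. Then the sparing number of $F_{m,n}$ is $n$, the length of the path $P_n$.
   Context: All graphs are simple and finite. For non-empty $A,B\subseteq\mathbb{N}_0$, the sum set is $A+B=\{a+b:a\in A,b\in B\}$. An integer additive set-indexer (IASI) of a graph $G$ is an injective map $f:V(G)\to\mathcal{P}(\mathbb{N}_0)$ such that the induced map $f^+:E(G)\to\mathcal{P}(\mathbb{N}_0)$, $f^+(uv)=f(u)+f(v)$, is also injective. The set-indexing number of a vertex or edge is the cardinality of its label. An IASI $f$ is a weak IASI if $|f^+(uv)|=\max(|f(u)|,|f(v)|)$ for every edge $uv$; a graph admitting one is a weak IASI graph. An element (vertex or edge) with set-indexing number $1$ is mono-indexed. The sparing number $\varphi(G)$ of $G$ is the minimum number of mono-indexed edges required for $G$ to admit a weak IASI. The join $G_1+G_2$ of graphs $G_1,G_2$ has vertex set $V(G_1)\cup V(G_2)$ and edge set $E(G_1)\cup E(G_2)\cup\{uv:u\in V(G_1),v\in V(G_2)\}$. $\overline{K}_m$ is the edgeless graph on $m$ vertices. -}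

module Defs where

open import Data.Bool using (Bool; true; false; _∨_; _∧_; T)
open import Data.Bool.Properties using (∨-comm)
import Data.Bool as B
open import Data.Nat using (ℕ; zero; suc; _+_; _⊔_; _≤_; _<_; _≟_; _<ᵇ_)
open import Data.Nat.Properties using (1+n≢n)
open import Data.Fin using (Fin; toℕ; splitAt)
open import Data.Sum using (_⊎_; inj₁; inj₂)
open import Data.Product using (_×_; _,_; Σ; ∃; proj₁; proj₂)
open import Data.List using (List; []; _∷_; length; filter; concatMap; map; cartesianProduct; deduplicate)
import Data.List as L
open import Data.List.Membership.Propositional using (_∈_)
open import Relation.Nullary using (¬_; yes; no)
open import Relation.Nullary.Decidable using (⌊_⌋)
open import Relation.Binary.PropositionalEquality using (_≡_; refl; sym)
open import Function using (_⇔_)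

record Graph : Set where
  field
    order : ℕ
    adj   : Fin order → Fin order → Bool
    adj-sym : ∀ u v → adj u v ≡ adj v u
    adj-irr : ∀ v → adj v v ≡ false
open Graph public

allFin : (n : ℕ) → List (Fin n)
allFin n = L.tabulate (λ i → i)

edges : (G : Graph) → List (Fin (order G) × Fin (order G))
edges G = filter (λ p → (adj G (proj₁ p) (proj₂ p) ∧ (toℕ (proj₁ p) <ᵇ toℕ (proj₂ p))) B.≟ true)
                 (cartesianProduct (allFin (order G)) (allFin (order G)))

pathAdj : (n : ℕ) → Fin (suc n) → Fin (suc n) → Bool
pathAdj n i j = ⌊ suc (toℕ i) ≟ toℕ j ⌋ ∨ ⌊ suc (toℕ j) ≟ toℕ i ⌋

private
  pathIrr : ∀ k → ⌊ suc k ≟ k ⌋ ∨ ⌊ suc k ≟ k ⌋ ≡ false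
  pathIrr k with suc k ≟ k
  ... | yes e = Data.Empty.⊥-elim (1+n≢n e)
    where import Data.Empty
  ... | no _ = refl

P : ℕ → Graph
P n = record
  { order = suc n
  ; adj = pathAdj n
  ; adj-sym = λ i j → ∨-comm ⌊ suc (toℕ i) ≟ toℕ j ⌋ ⌊ suc (toℕ j) ≟ toℕ i ⌋
  ; adj-irr = λ i → pathIrr (toℕ i)
  }

Kbar : ℕ → Graph
Kbar m = record { order = m ; adj = λ _ _ → false ; adj-sym = λ _ _ → refl ; adj-irr = λ _ → refl }

joinAdj : (G₁ G₂ : Graph) → Fin (order G₁ + order G₂) → Fin (order G₁ + order G₂) → Bool
joinAdj G₁ G₂ u v with splitAt (order G₁) u | splitAt (order G₁) v
... | inj₁ a | inj₁ b = adj G₁ a b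
... | inj₂ a | inj₂ b = adj G₂ a b
... | inj₁ _ | inj₂ _ = true
... | inj₂ _ | inj₁ _ = true

private
  joinSym : ∀ G₁ G₂ u v → joinAdj G₁ G₂ u v ≡ joinAdj G₁ G₂ v u
  joinSym G₁ G₂ u v with splitAt (order G₁) u | splitAt (order G₁) v
  ... | inj₁ a | inj₁ b = adj-sym G₁ a b
  ... | inj₂ a | inj₂ b = adj-sym G₂ a b
  ... | inj₁ _ | inj₂ _ = refl
  ... | inj₂ _ | inj₁ _ = refl

  joinIrr : ∀ G₁ G₂ v → joinAdj G₁ G₂ v v ≡ false
  joinIrr G₁ G₂ v with splitAt (order G₁) v
  ... | inj₁ a = adj-irr G₁ a
  ... | inj₂ a = adj-irr G₂ a

_⊕_ : Graph → Graph → Graph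
G₁ ⊕ G₂ = record
  { order = order G₁ + order G₂
  ; adj = joinAdj G₁ G₂
  ; adj-sym = joinSym G₁ G₂
  ; adj-irr = joinIrr G₁ G₂
  }

Fan : ℕ → ℕ → Graph
Fan m n = P n ⊕ Kbar m

-- Finite subsets of ℕ₀, represented by lists (order/repetition irrelevant).

FinSet : Set
FinSet = List ℕ

_≐_ : FinSet → FinSet → Set
A ≐ B = ∀ x → (x ∈ A) ⇔ (x ∈ B)

card : FinSet → ℕ
card A = length (deduplicate _≟_ A)

_⊞_ : FinSet → FinSet → FinSet
A ⊞ B = concatMap (λ a → map (a +_) B) A

module _ (G : Graph) where

  Label : Set
  Label = Fin (order G) → FinSet

  edgeLabel : Label → Fin (order G) × Fin (order G) → FinSet
  edgeLabel f e = f (proj₁ e) ⊞ f (proj₂ e)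

  record IsIASI (f : Label) : Set where
    field
      nonempty : ∀ v → ¬ (f v ≡ [])
      f-inj    : ∀ u v → f u ≐ f v → u ≡ v
      f⁺-inj   : ∀ e e′ → e ∈ edges G → e′ ∈ edges G →
                 edgeLabel f e ≐ edgeLabel f e′ → e ≡ e′

  record IsWeakIASI (f : Label) : Set where
    field
      iasi : IsIASI f
      weak : ∀ e → e ∈ edges G →
             card (edgeLabel f e) ≡ card (f (proj₁ e)) ⊔ card (f (proj₂ e))

  monoEdgeCount : Label → ℕ
  monoEdgeCount f = length (filter (λ e → card (edgeLabel f e) ≟ 1) (edges G))

  IsSparingNumber : ℕ → Set
  IsSparingNumber k =
    (Σ Label λ f → IsWeakIASI f × monoEdgeCount f ≡ k)
    × (∀ f → IsWeakIASI f → k ≤ monoEdgeCount f)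

-- In a weak IASI every edge has a mono-indexed end, because |A + B| > max(|A|, |B|) as soon as
-- |A|, |B| ≥ 2 (shift A by the smaller of two elements of B and add max A plus the larger one).
-- If some vertex of K̄_m is not mono-indexed, all path vertices are, so all n path edges are
-- mono-indexed. Otherwise two vertices u₀, u₁ of K̄_m are mono-indexed; choosing a mono-indexed
-- end x_k of the k-th path edge, the spokes x_k u_(k mod 2) are n distinct mono-indexed edges.
-- Conversely, labelling path vertex i by {i} and the j-th vertex of K̄_m by {(n+1)j, (n+1)j+1}
-- gives a weak IASI: the spoke from i to j gets {x, x+1} with x = (n+1)j + i, which determines
-- the spoke, so only the n path edges are mono-indexed.
module Submission where

open import Defs
open import Data.Bool using (Bool; true; false; T; _∧_; not)
import Data.Bool as B
open import Data.Bool.Properties using (T-≡; T-∧; T-∨; not-¬)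
open import Data.Fin as Fin using (Fin; toℕ; combine; _↑ˡ_; _↑ʳ_; splitAt; inject₁)
import Data.Fin.Properties as Finₚ
open import Data.Fin.Properties using (toℕ-injective; toℕ-combine; combine-injective; ↑ˡ-injective; ↑ʳ-injective; toℕ-inject₁; toℕ-↑ˡ; toℕ-↑ʳ; toℕ<n; splitAt-↑ˡ; splitAt-↑ʳ; splitAt⁻¹-↑ˡ; splitAt⁻¹-↑ʳ)
open import Relation.Nullary.Decidable using (⌊_⌋; toWitness; fromWitness)
open import Function.Bundles using (Equivalence)
open import Function.Properties.Equivalence using () renaming (sym to ⇔-sym)
open import Data.Nat using (ℕ; zero; suc; _+_; _*_; ⌊_/2⌋; _≡ᵇ_; _≤_; _<_; _⊔_; _≟_; _<ᵇ_; z≤n; s≤s)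
open import Data.Nat.Properties
open import Data.List using (List; []; _∷_; length; map; filter; tabulate; deduplicate; cartesianProduct)
open import Data.List.Properties using (length-map; length-tabulate; length-removeAt′)
open import Data.List.Extrema ≤-totalOrder using (max; argmax-sel; ⊥≤max; xs≤max)
open import Data.List.Membership.Propositional using (_∈_; find)
open import Data.List.Membership.Propositional.Properties
open import Data.List.Relation.Binary.Subset.Propositional using (_⊆_)
open import Data.List.Relation.Unary.Any as Any using (here; there; index; _─_)
open import Data.List.Relation.Unary.All as All using (All; _∷_)
open import Data.List.Relation.Unary.AllPairs using (_∷_)
open import Data.List.Relation.Unary.Unique.Propositional using (Unique)
import Data.List.Relation.Unary.Unique.Propositional.Properties as Unique
open import Data.List.Relation.Unary.Unique.DecPropositional.Properties _≟_ using (deduplicate-!)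
open import Data.Product using (_×_; _,_; ∃; ∃₂; proj₁; proj₂)
open import Data.Sum using (_⊎_; inj₁; inj₂; [_,_]′)
open import Data.Empty using (⊥-elim)
open import Relation.Nullary using (¬_; Dec; contradiction; yes; no)
open import Relation.Binary using (tri<; tri≈; tri>)
open import Relation.Binary.PropositionalEquality
open import Function using (id; _∘′_; case_of_)

∈-─⁺ : ∀ {A : Set} {x y : A} {xs} (y∈xs : y ∈ xs) → x ∈ xs → x ≢ y → x ∈ (xs ─ y∈xs)
∈-─⁺ (here refl) (here refl) x≢y = contradiction refl x≢y
∈-─⁺ (here refl) (there x∈xs) _  = x∈xs
∈-─⁺ (there _)   (here refl) _   = here refl
∈-─⁺ (there y∈xs) (there x∈xs) x≢y = there (∈-─⁺ y∈xs x∈xs x≢y)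

Unique-⊆⇒length≤ : ∀ {A : Set} {xs ys : List A} → Unique xs → xs ⊆ ys → length xs ≤ length ys
Unique-⊆⇒length≤ {xs = []}     _                _     = z≤n
Unique-⊆⇒length≤ {xs = x ∷ xs} {ys} (x∉xs ∷ !xs) xs⊆ys = begin
  suc (length xs)          ≤⟨ s≤s (Unique-⊆⇒length≤ !xs xs⊆ys─x) ⟩
  suc (length (ys ─ x∈ys)) ≡⟨ length-removeAt′ ys (index x∈ys) ⟨
  length ys                ∎
  where
  open ≤-Reasoning
  x∈ys = xs⊆ys (here refl)
  xs⊆ys─x : xs ⊆ (ys ─ x∈ys)
  xs⊆ys─x z∈xs = ∈-─⁺ x∈ys (xs⊆ys (there z∈xs)) (λ z≡x → All.lookup x∉xs z∈xs (sym z≡x))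

injection⇒≤length : ∀ {A : Set} {n} {xs : List A} (g : Fin n → A) →
                    (∀ {k k′} → g k ≡ g k′ → k ≡ k′) → (∀ k → g k ∈ xs) → n ≤ length xs
injection⇒≤length g g-inj g∈xs = subst (_≤ _) (length-tabulate g)
  (Unique-⊆⇒length≤ (Unique.tabulate⁺ g-inj) λ x∈g[Fin] → case ∈-tabulate⁻ x∈g[Fin] of λ where
    (k , refl) → g∈xs k)

Unique-⊆-tabulate⇒length≤ : ∀ {A : Set} {n} {xs : List A} (g : Fin n → A) →
                            Unique xs → xs ⊆ tabulate g → length xs ≤ n
Unique-⊆-tabulate⇒length≤ g !xs xs⊆g[Fin] =
  subst (_ ≤_) (length-tabulate g) (Unique-⊆⇒length≤ !xs xs⊆g[Fin])

Unique-⊆⇒length≤card : ∀ {xs A : List ℕ} → Unique xs → xs ⊆ A → length xs ≤ card A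
Unique-⊆⇒length≤card !xs xs⊆A = Unique-⊆⇒length≤ !xs (∈-deduplicate⁺ _≟_ ∘′ xs⊆A)

card-mono : ∀ {A B : FinSet} → A ⊆ B → card A ≤ card B
card-mono {A} A⊆B = Unique-⊆⇒length≤card (deduplicate-! A) (A⊆B ∘′ ∈-deduplicate⁻ _≟_ A)

card-nonempty : ∀ {A : FinSet} → ¬ A ≡ [] → 1 ≤ card A
card-nonempty {[]}    A≢[] = contradiction refl A≢[]
card-nonempty {_ ∷ _} _    = s≤s z≤n

card-nonsingleton : ∀ {C : FinSet} → ¬ C ≡ [] → card C ≢ 1 → 2 ≤ card C
card-nonsingleton C≢[] |C|≢1 = ≤∧≢⇒< (card-nonempty C≢[]) (|C|≢1 ∘′ sym)

pair : ℕ → FinSet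
pair a = a ∷ suc a ∷ []

card-pair : ∀ a → card (pair a) ≡ 2
card-pair a with a ≡ᵇ suc a in eq
... | true  = contradiction (sym (≡ᵇ⇒≡ a (suc a) (Equivalence.from T-≡ eq))) 1+n≢n
... | false = refl

singleton-⊞-pair : ∀ a b → (a ∷ []) ⊞ pair b ≡ pair (a + b)
singleton-⊞-pair a b = cong (λ x → a + b ∷ x ∷ []) (+-suc a b)

∈-pair⇒≥ : ∀ {x a} → x ∈ pair a → a ≤ x
∈-pair⇒≥ (here refl)         = ≤-refl
∈-pair⇒≥ (there (here refl)) = n≤1+n _

≐-sym : ∀ {A B : FinSet} → A ≐ B → B ≐ A
≐-sym A≐B x = ⇔-sym (A≐B x)

singleton-≐-injective : ∀ {a b} → (a ∷ []) ≐ (b ∷ []) → a ≡ b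
singleton-≐-injective {a} eq with here a≡b ← Equivalence.to (eq a) (here refl) = a≡b

pair-≐-injective : ∀ {a b} → pair a ≐ pair b → a ≡ b
pair-≐-injective {a} {b} eq =
  ≤-antisym (∈-pair⇒≥ (Equivalence.from (eq b) (here refl))) (∈-pair⇒≥ (Equivalence.to (eq a) (here refl)))

singleton≭pair : ∀ {a b} → ¬ (a ∷ []) ≐ pair b
singleton≭pair {b = b} eq
  with here refl ← Equivalence.from (eq b) (here refl)
  with here 1+b≡b ← Equivalence.from (eq (suc b)) (there (here refl)) = 1+n≢n 1+b≡b

∈-⊞⁺ : ∀ {a b} {A B : FinSet} → a ∈ A → b ∈ B → a + b ∈ A ⊞ B
∈-⊞⁺ {B = B} a∈A b∈B = ∈-concatMap⁺ (λ a → map (a +_) B) (Any.map (λ { refl → ∈-map⁺ (_ +_) b∈B }) a∈A)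

∈-⊞⁻ : ∀ {x} (A B : FinSet) → x ∈ A ⊞ B → ∃₂ λ a b → a ∈ A × b ∈ B × x ≡ a + b
∈-⊞⁻ A B x∈A⊞B with a , a∈A , x∈a+B ← find (∈-concatMap⁻ (λ a → map (a +_) B) {xs = A} x∈A⊞B)
  with b , b∈B , refl ← ∈-map⁻ (a +_) x∈a+B = a , b , a∈A , b∈B , refl

⊞-comm-⊆ : ∀ (A B : FinSet) → A ⊞ B ⊆ B ⊞ A
⊞-comm-⊆ A B x∈A⊞B with a , b , a∈A , b∈B , refl ← ∈-⊞⁻ A B x∈A⊞B =
  subst (_∈ B ⊞ A) (+-comm b a) (∈-⊞⁺ {A = B} b∈B a∈A)

card-⊞-comm : ∀ (A B : FinSet) → card (A ⊞ B) ≡ card (B ⊞ A)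
card-⊞-comm A B = ≤-antisym (card-mono (⊞-comm-⊆ A B)) (card-mono (⊞-comm-⊆ B A))

Unique⇒ordered-pair : ∀ {E : List ℕ} → Unique E → 2 ≤ length E → ∃₂ λ lo hi → lo < hi × lo ∈ E × hi ∈ E
Unique⇒ordered-pair {x ∷ y ∷ _} ((x≢y ∷ _) ∷ _) _ with <-cmp x y
... | tri< x<y _ _ = x , y , x<y , here refl , there (here refl)
... | tri≈ _ x≡y _ = contradiction x≡y x≢y
... | tri> _ _ y<x = y , x , y<x , there (here refl) , here refl
Unique⇒ordered-pair {_ ∷ []} _ (s≤s ())

⊞-growth : ∀ {A B : FinSet} {d ds lo hi} → Unique (d ∷ ds) → d ∷ ds ⊆ A →
           lo < hi → lo ∈ B → hi ∈ B → suc (length (d ∷ ds)) ≤ card (A ⊞ B)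
⊞-growth {A} {B} {d} {ds} {lo} {hi} !D D⊆A lo<hi lo∈B hi∈B =
  subst (_≤ card (A ⊞ B)) (cong suc (length-map (_+ lo) (d ∷ ds)))
    (Unique-⊆⇒length≤card (top∉shifted ∷ Unique.map⁺ (+-cancelʳ-≡ lo _ _) !D) sums⊆A⊞B)
  where
  top = max d ds + hi
  max∈D : max d ds ∈ d ∷ ds
  max∈D with argmax-sel id d ds
  ... | inj₁ max≡d  = here max≡d
  ... | inj₂ max∈ds = there max∈ds
  D≤max : All (_≤ max d ds) (d ∷ ds)
  D≤max = ⊥≤max d ds ∷ xs≤max d ds
  top∉shifted : All (top ≢_) (map (_+ lo) (d ∷ ds))
  top∉shifted = All.tabulate λ x∈shifted → case ∈-map⁻ (_+ lo) x∈shifted of λ where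
    (x , x∈D , refl) → >⇒≢ (+-mono-≤-< (All.lookup D≤max x∈D) lo<hi)
  sums⊆A⊞B : top ∷ map (_+ lo) (d ∷ ds) ⊆ A ⊞ B
  sums⊆A⊞B (here refl) = ∈-⊞⁺ (D⊆A max∈D) hi∈B
  sums⊆A⊞B (there y∈shifted) with x , x∈D , refl ← ∈-map⁻ (_+ lo) y∈shifted = ∈-⊞⁺ (D⊆A x∈D) lo∈B

card-⊞-growth : ∀ (A B : FinSet) → 1 ≤ card A → 2 ≤ card B → card A < card (A ⊞ B)
card-⊞-growth A B 1≤|A| 2≤|B|
  with lo , hi , lo<hi , lo∈ , hi∈ ← Unique⇒ordered-pair (deduplicate-! B) 2≤|B| =
  growth (deduplicate-! A) (∈-deduplicate⁻ _≟_ A) 1≤|A|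
  where
  growth : ∀ {D} → Unique D → D ⊆ A → 1 ≤ length D → length D < card (A ⊞ B)
  growth {_ ∷ _} !D D⊆A _ =
    ⊞-growth !D D⊆A lo<hi (∈-deduplicate⁻ _≟_ B lo∈) (∈-deduplicate⁻ _≟_ B hi∈)

card-⊞-exceeds-⊔ : ∀ (A B : FinSet) → 2 ≤ card A → 2 ≤ card B → card A ⊔ card B < card (A ⊞ B)
card-⊞-exceeds-⊔ A B 2≤|A| 2≤|B| = ⊔-lub
  (card-⊞-growth A B (<⇒≤ 2≤|A|) 2≤|B|)
  (subst (card B <_) (card-⊞-comm B A) (card-⊞-growth B A (<⇒≤ 2≤|B|) 2≤|A|))

weak-sum⇒singleton : ∀ (A B : FinSet) → ¬ A ≡ [] → ¬ B ≡ [] →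
                     card (A ⊞ B) ≡ card A ⊔ card B → card A ≡ 1 ⊎ card B ≡ 1
weak-sum⇒singleton A B A≢[] B≢[] weak with card A ≟ 1 | card B ≟ 1
... | yes |A|≡1 | _         = inj₁ |A|≡1
... | no _      | yes |B|≡1 = inj₂ |B|≡1
... | no |A|≢1  | no |B|≢1  = contradiction weak
  (>⇒≢ (card-⊞-exceeds-⊔ A B (card-nonsingleton A≢[] |A|≢1) (card-nonsingleton B≢[] |B|≢1)))

module _ (G : Graph) where

  private
    edge? = λ (p : Fin (order G) × Fin (order G)) →
      (adj G (proj₁ p) (proj₂ p) ∧ (toℕ (proj₁ p) <ᵇ toℕ (proj₂ p))) B.≟ true
    vertexPairs = cartesianProduct (allFin (order G)) (allFin (order G))

  ∈-edges⁺ : ∀ {u v} → T (adj G u v) → toℕ u < toℕ v → (u , v) ∈ edges G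
  ∈-edges⁺ {u} {v} uv u<v = ∈-filter⁺ edge? (∈-cartesianProduct⁺ (∈-tabulate⁺ u) (∈-tabulate⁺ v))
    (Equivalence.to T-≡ (Equivalence.from T-∧ (uv , <⇒<ᵇ u<v)))

  ∈-edges⁻ : ∀ {u v} → (u , v) ∈ edges G → T (adj G u v) × toℕ u < toℕ v
  ∈-edges⁻ uv∈E
    with uv , u<ᵇv ← Equivalence.to T-∧ (Equivalence.from T-≡ (proj₂ (∈-filter⁻ edge? {xs = vertexPairs} uv∈E)))
    = uv , <ᵇ⇒< _ _ u<ᵇv

  edges-unique : Unique (edges G)
  edges-unique = Unique.filter⁺ edge? (Unique.cartesianProduct⁺ (Unique.tabulate⁺ id) (Unique.tabulate⁺ id))

data Summand (k l : ℕ) : Fin (k + l) → Set where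
  left  : (a : Fin k) → Summand k l (a ↑ˡ l)
  right : (b : Fin l) → Summand k l (k ↑ʳ b)

summand : ∀ k {l} (u : Fin (k + l)) → Summand k l u
summand k {l} u with splitAt k u in eq
... | inj₁ a = subst (Summand k l) (splitAt⁻¹-↑ˡ eq) (left a)
... | inj₂ b = subst (Summand k l) (splitAt⁻¹-↑ʳ eq) (right b)

module _ (G₁ G₂ : Graph) where

  adj-⊕-↑ˡ-↑ˡ : ∀ a b → adj (G₁ ⊕ G₂) (a ↑ˡ order G₂) (b ↑ˡ order G₂) ≡ adj G₁ a b
  adj-⊕-↑ˡ-↑ˡ a b rewrite splitAt-↑ˡ (order G₁) a (order G₂) | splitAt-↑ˡ (order G₁) b (order G₂) = refl

  adj-⊕-↑ˡ-↑ʳ : ∀ a b → adj (G₁ ⊕ G₂) (a ↑ˡ order G₂) (order G₁ ↑ʳ b) ≡ true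
  adj-⊕-↑ˡ-↑ʳ a b rewrite splitAt-↑ˡ (order G₁) a (order G₂) | splitAt-↑ʳ (order G₁) (order G₂) b = refl

  adj-⊕-↑ʳ-↑ʳ : ∀ a b → adj (G₁ ⊕ G₂) (order G₁ ↑ʳ a) (order G₁ ↑ʳ b) ≡ adj G₂ a b
  adj-⊕-↑ʳ-↑ʳ a b rewrite splitAt-↑ʳ (order G₁) (order G₂) a | splitAt-↑ʳ (order G₁) (order G₂) b = refl

pathAdj-inject₁-suc : ∀ {n} (k : Fin n) → T (pathAdj n (inject₁ k) (Fin.suc k))
pathAdj-inject₁-suc k =
  Equivalence.from T-∨ (inj₁ (fromWitness {a? = suc (toℕ (inject₁ k)) ≟ suc (toℕ k)} (cong suc (toℕ-inject₁ k))))

pathAdj-<⇒consecutive : ∀ {n} {i j : Fin (suc n)} → T (pathAdj n i j) → toℕ i < toℕ j →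
                        ∃ λ k → i ≡ inject₁ k × j ≡ Fin.suc k
pathAdj-<⇒consecutive {i = i} {j} ij i<j with Equivalence.to (T-∨ {⌊ suc (toℕ i) ≟ toℕ j ⌋}) ij
... | inj₂ 1+j≡i = contradiction (≤-reflexive (toWitness {a? = suc (toℕ j) ≟ toℕ i} 1+j≡i)) (<-asym i<j)
... | inj₁ 1+i≡j = consecutive (toWitness {a? = suc (toℕ i) ≟ toℕ j} 1+i≡j)
  where
  consecutive : ∀ {j} → suc (toℕ i) ≡ toℕ j → ∃ λ k → i ≡ inject₁ k × j ≡ Fin.suc k
  consecutive {Fin.suc k} 1+i≡1+k = k , toℕ-injective (trans (suc-injective 1+i≡1+k) (sym (toℕ-inject₁ k))) , refl

monoIndexed? : (G : Graph) (f : Label G) (e : Fin (order G) × Fin (order G)) → Dec (card (edgeLabel G f e) ≡ 1)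
monoIndexed? G f e = card (edgeLabel G f e) ≟ 1

monoEdges : (G : Graph) → Label G → List (Fin (order G) × Fin (order G))
monoEdges G f = filter (monoIndexed? G f) (edges G)

module WeakIASI {G : Graph} {f : Label G} (weakIASI : IsWeakIASI G f) where
  open IsWeakIASI weakIASI
  open IsIASI iasi

  MonoIndexed : Fin (order G) → Set
  MonoIndexed v = card (f v) ≡ 1

  monoIndexedEnd : ∀ {u v} → (u , v) ∈ edges G → MonoIndexed u ⊎ MonoIndexed v
  monoIndexedEnd uv∈E = weak-sum⇒singleton _ _ (nonempty _) (nonempty _) (weak _ uv∈E)

  monoIndexedEdge : ∀ {u v} → (u , v) ∈ edges G → MonoIndexed u → MonoIndexed v → (u , v) ∈ monoEdges G f
  monoIndexedEdge uv∈E |u|≡1 |v|≡1 = ∈-filter⁺ (monoIndexed? G f) uv∈E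
    (trans (weak _ uv∈E) (cong₂ _⊔_ |u|≡1 |v|≡1))

module FanGraph (m n : ℕ) where

  Vertex : Set
  Vertex = Fin (order (Fan m n))

  pathVertex : Fin (suc n) → Vertex
  pathVertex i = i ↑ˡ m

  hubVertex : Fin m → Vertex
  hubVertex j = suc n ↑ʳ j

  pathEdge : Fin n → Vertex × Vertex
  pathEdge k = pathVertex (inject₁ k) , pathVertex (Fin.suc k)

  spokeEdge : Fin (suc n) → Fin m → Vertex × Vertex
  spokeEdge i j = pathVertex i , hubVertex j

  data EdgeKind : Vertex × Vertex → Set where
    path  : ∀ k → EdgeKind (pathEdge k)
    spoke : ∀ i j → EdgeKind (spokeEdge i j)

  pathEdge∈edges : ∀ k → pathEdge k ∈ edges (Fan m n)
  pathEdge∈edges k = ∈-edges⁺ (Fan m n)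
    (subst T (sym (adj-⊕-↑ˡ-↑ˡ (P n) (Kbar m) (inject₁ k) (Fin.suc k))) (pathAdj-inject₁-suc k))
    (subst₂ _<_ (sym (trans (toℕ-↑ˡ (inject₁ k) m) (toℕ-inject₁ k))) (sym (toℕ-↑ˡ (Fin.suc k) m)) ≤-refl)

  spokeEdge∈edges : ∀ i j → spokeEdge i j ∈ edges (Fan m n)
  spokeEdge∈edges i j = ∈-edges⁺ (Fan m n)
    (subst T (sym (adj-⊕-↑ˡ-↑ʳ (P n) (Kbar m) i j)) _)
    (subst₂ _<_ (sym (toℕ-↑ˡ i m)) (sym (toℕ-↑ʳ (suc n) j)) (<-≤-trans (toℕ<n i) (m≤m+n (suc n) (toℕ j))))

  edgeKind : ∀ {e} → e ∈ edges (Fan m n) → EdgeKind e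
  edgeKind {u , v} uv∈E with summand (suc n) u | summand (suc n) v
  ... | left a | right b = spoke a b
  ... | left a | left b
    with uv , u<v ← ∈-edges⁻ (Fan m n) uv∈E
    with k , refl , refl ← pathAdj-<⇒consecutive (subst T (adj-⊕-↑ˡ-↑ˡ (P n) (Kbar m) a b) uv)
                                              (subst₂ _<_ (toℕ-↑ˡ a m) (toℕ-↑ˡ b m) u<v)
    = path k
  ... | right a | right b
    with uv , _ ← ∈-edges⁻ (Fan m n) uv∈E = ⊥-elim (subst T (adj-⊕-↑ʳ-↑ʳ (P n) (Kbar m) a b) uv)
  ... | right a | left b
    with _ , u<v ← ∈-edges⁻ (Fan m n) uv∈E = contradiction
      (subst₂ _<_ (toℕ-↑ʳ (suc n) a) (toℕ-↑ˡ b m) u<v)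
      (<-asym (<-≤-trans (toℕ<n b) (m≤m+n (suc n) (toℕ a))))

  pathEdge-injective : ∀ {k k′} → pathEdge k ≡ pathEdge k′ → k ≡ k′
  pathEdge-injective e = Finₚ.suc-injective (↑ˡ-injective m _ _ (cong proj₂ e))

  spokeEdge-injective : ∀ {i i′ j j′} → spokeEdge i j ≡ spokeEdge i′ j′ → i ≡ i′ × j ≡ j′
  spokeEdge-injective e = ↑ˡ-injective m _ _ (cong proj₁ e) , ↑ʳ-injective (suc n) _ _ (cong proj₂ e)

parity : ℕ → Bool
parity zero    = false
parity (suc t) = not (parity t)

same-parity-neighbour⇒≡ : ∀ {x t t′} → parity t ≡ parity t′ →
                          x ≡ t ⊎ x ≡ suc t → x ≡ t′ ⊎ x ≡ suc t′ → t ≡ t′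
same-parity-neighbour⇒≡ _ (inj₁ refl) (inj₁ x≡t′)  = x≡t′
same-parity-neighbour⇒≡ _ (inj₂ refl) (inj₂ x≡1+t′) = suc-injective x≡1+t′
same-parity-neighbour⇒≡ p (inj₁ refl) (inj₂ refl)  = contradiction (sym p) (not-¬ refl)
same-parity-neighbour⇒≡ p (inj₂ refl) (inj₁ refl)  = contradiction p (not-¬ refl)

module LowerBound {m n : ℕ} {f : Label (Fan m n)} (weakIASI : IsWeakIASI (Fan m n) f) where
  open FanGraph m n
  open WeakIASI weakIASI

  monoPath⇒count≥n : (∀ i → MonoIndexed (pathVertex i)) → n ≤ monoEdgeCount (Fan m n) f
  monoPath⇒count≥n mono = injection⇒≤length pathEdge pathEdge-injective λ k →
    monoIndexedEdge (pathEdge∈edges k) (mono (inject₁ k)) (mono (Fin.suc k))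

  nonMonoHub⇒monoPath : ∀ {j} → ¬ MonoIndexed (hubVertex j) → ∀ i → MonoIndexed (pathVertex i)
  nonMonoHub⇒monoPath ¬mono i with monoIndexedEnd (spokeEdge∈edges i _)
  ... | inj₁ mono = mono
  ... | inj₂ mono = contradiction mono ¬mono

  monoPathEnd : ∀ k → ∃ λ x → MonoIndexed (pathVertex x) × (toℕ x ≡ toℕ k ⊎ toℕ x ≡ suc (toℕ k))
  monoPathEnd k with monoIndexedEnd (pathEdge∈edges k)
  ... | inj₁ mono = inject₁ k , mono , inj₁ (toℕ-inject₁ k)
  ... | inj₂ mono = Fin.suc k , mono , inj₂ refl

  monoHubs⇒count≥n : (hub : Bool → Fin m) → (∀ {b b′} → hub b ≡ hub b′ → b ≡ b′) →
                     (∀ b → MonoIndexed (hubVertex (hub b))) → n ≤ monoEdgeCount (Fan m n) f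
  monoHubs⇒count≥n hub hub-inj mono = injection⇒≤length charged charged-injective λ k →
    monoIndexedEdge (spokeEdge∈edges _ _) (proj₁ (proj₂ (monoPathEnd k))) (mono _)
    where
    charged : Fin n → Vertex × Vertex
    charged k = spokeEdge (proj₁ (monoPathEnd k)) (hub (parity (toℕ k)))
    charged-injective : ∀ {k k′} → charged k ≡ charged k′ → k ≡ k′
    charged-injective {k} {k′} e with x≡x′ , same-hub ← spokeEdge-injective e =
      toℕ-injective (same-parity-neighbour⇒≡ (hub-inj same-hub)
        (proj₂ (proj₂ (monoPathEnd k)))
        (subst (λ x → toℕ x ≡ toℕ k′ ⊎ toℕ x ≡ suc (toℕ k′)) (sym x≡x′) (proj₂ (proj₂ (monoPathEnd k′)))))

  twoHubs⇒count≥n : ∀ {j₀ j₁} → j₀ ≢ j₁ → n ≤ monoEdgeCount (Fan m n) f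
  twoHubs⇒count≥n {j₀} {j₁} j₀≢j₁ with card (f (hubVertex j₀)) ≟ 1 | card (f (hubVertex j₁)) ≟ 1
  ... | no ¬mono₀ | _         = monoPath⇒count≥n (nonMonoHub⇒monoPath ¬mono₀)
  ... | yes _     | no ¬mono₁ = monoPath⇒count≥n (nonMonoHub⇒monoPath ¬mono₁)
  ... | yes mono₀ | yes mono₁ = monoHubs⇒count≥n hub hub-injective λ { true → mono₀ ; false → mono₁ }
    where
    hub : Bool → Fin m
    hub true  = j₀
    hub false = j₁
    hub-injective : ∀ {b b′} → hub b ≡ hub b′ → b ≡ b′
    hub-injective {true}  {true}  _     = refl
    hub-injective {false} {false} _     = refl
    hub-injective {true}  {false} j₀≡j₁ = contradiction j₀≡j₁ j₀≢j₁
    hub-injective {false} {true}  j₁≡j₀ = contradiction (sym j₁≡j₀) j₀≢j₁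

sparing-lower-bound : ∀ {m n} → 1 < m → ∀ {f} → IsWeakIASI (Fan m n) f → n ≤ monoEdgeCount (Fan m n) f
sparing-lower-bound {suc (suc _)} (s≤s (s≤s z≤n)) weakIASI =
  LowerBound.twoHubs⇒count≥n weakIASI {Fin.zero} {Fin.suc Fin.zero} λ ()

m+1+m-injective : ∀ {a b} → a + suc a ≡ b + suc b → a ≡ b
m+1+m-injective {a} {b} e = begin
  a              ≡⟨ n≡⌊n+n/2⌋ a ⟩
  ⌊ a + a /2⌋    ≡⟨ cong ⌊_/2⌋ (suc-injective (trans (sym (+-suc a a)) (trans e (+-suc b b)))) ⟩
  ⌊ b + b /2⌋    ≡⟨ n≡⌊n+n/2⌋ b ⟨
  b              ∎
  where open ≡-Reasoning

module Construction (m n : ℕ) where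
  open FanGraph m n

  label : Label (Fan m n)
  label v = [ (λ i → toℕ i ∷ []) , (λ j → pair (suc n * toℕ j)) ]′ (splitAt (suc n) v)

  label-pathVertex : ∀ i → label (pathVertex i) ≡ toℕ i ∷ []
  label-pathVertex i = cong [ _ , _ ]′ (splitAt-↑ˡ (suc n) i m)

  label-hubVertex : ∀ j → label (hubVertex j) ≡ pair (suc n * toℕ j)
  label-hubVertex j = cong [ _ , _ ]′ (splitAt-↑ʳ (suc n) m j)

  label-nonempty : ∀ v → ¬ label v ≡ []
  label-nonempty v with splitAt (suc n) v
  ... | inj₁ _ = λ ()
  ... | inj₂ _ = λ ()

  label-injective : ∀ u v → label u ≐ label v → u ≡ v
  label-injective u v eq with summand (suc n) u | summand (suc n) v
  ... | left i  | left i′  = cong pathVertex (toℕ-injective (singleton-≐-injective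
    (subst₂ _≐_ (label-pathVertex i) (label-pathVertex i′) eq)))
  ... | left i  | right j  = ⊥-elim (singleton≭pair (subst₂ _≐_ (label-pathVertex i) (label-hubVertex j) eq))
  ... | right j | left i   = ⊥-elim (singleton≭pair (subst₂ _≐_ (label-pathVertex i) (label-hubVertex j) (≐-sym eq)))
  ... | right j | right j′ = cong hubVertex (toℕ-injective (*-cancelˡ-≡ _ _ (suc n) (pair-≐-injective
    (subst₂ _≐_ (label-hubVertex j) (label-hubVertex j′) eq))))

  pathEdge-label : ∀ k → edgeLabel (Fan m n) label (pathEdge k) ≡ toℕ k + suc (toℕ k) ∷ []
  pathEdge-label k = cong₂ _⊞_ (trans (label-pathVertex (inject₁ k)) (cong (_∷ []) (toℕ-inject₁ k)))
                               (label-pathVertex (Fin.suc k))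

  spokeEdge-label : ∀ i j → edgeLabel (Fan m n) label (spokeEdge i j) ≡ pair (toℕ (combine j i))
  spokeEdge-label i j = begin
    label (pathVertex i) ⊞ label (hubVertex j)  ≡⟨ cong₂ _⊞_ (label-pathVertex i) (label-hubVertex j) ⟩
    (toℕ i ∷ []) ⊞ pair (suc n * toℕ j)         ≡⟨ singleton-⊞-pair (toℕ i) _ ⟩
    pair (toℕ i + suc n * toℕ j)                ≡⟨ cong pair (+-comm (toℕ i) _) ⟩
    pair (suc n * toℕ j + toℕ i)                ≡⟨ cong pair (toℕ-combine j i) ⟨
    pair (toℕ (combine j i))                    ∎
    where open ≡-Reasoning

  edgeLabel-injective : ∀ e e′ → e ∈ edges (Fan m n) → e′ ∈ edges (Fan m n) →
                        edgeLabel (Fan m n) label e ≐ edgeLabel (Fan m n) label e′ → e ≡ e′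
  edgeLabel-injective _ _ e∈E e′∈E eq with edgeKind e∈E | edgeKind e′∈E
  ... | path k    | path k′     = cong pathEdge (toℕ-injective (m+1+m-injective (singleton-≐-injective
    (subst₂ _≐_ (pathEdge-label k) (pathEdge-label k′) eq))))
  ... | path k    | spoke i j   = ⊥-elim (singleton≭pair (subst₂ _≐_ (pathEdge-label k) (spokeEdge-label i j) eq))
  ... | spoke i j | path k      = ⊥-elim (singleton≭pair (subst₂ _≐_ (pathEdge-label k) (spokeEdge-label i j) (≐-sym eq)))
  ... | spoke i j | spoke i′ j′
    with refl , refl ← combine-injective j i j′ i′ (toℕ-injective (pair-≐-injective
      (subst₂ _≐_ (spokeEdge-label i j) (spokeEdge-label i′ j′) eq))) = refl

  spokeEdge-card : ∀ i j → card (edgeLabel (Fan m n) label (spokeEdge i j)) ≡ 2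
  spokeEdge-card i j = trans (cong card (spokeEdge-label i j)) (card-pair (toℕ (combine j i)))

  label-weak : ∀ e → e ∈ edges (Fan m n) →
               card (edgeLabel (Fan m n) label e) ≡ card (label (proj₁ e)) ⊔ card (label (proj₂ e))
  label-weak _ e∈E with edgeKind e∈E
  ... | path k = begin
    card (edgeLabel (Fan m n) label (pathEdge k))  ≡⟨ cong card (pathEdge-label k) ⟩
    1 ⊔ 1                                          ≡⟨ cong₂ _⊔_ (cong card (label-pathVertex (inject₁ k)))
                                                                (cong card (label-pathVertex (Fin.suc k))) ⟨
    card (label (pathVertex (inject₁ k))) ⊔ card (label (pathVertex (Fin.suc k))) ∎
    where open ≡-Reasoning
  ... | spoke i j = begin
    card (edgeLabel (Fan m n) label (spokeEdge i j))  ≡⟨ spokeEdge-card i j ⟩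
    1 ⊔ 2                                             ≡⟨ cong₂ _⊔_ (cong card (label-pathVertex i))
                                                                   (trans (cong card (label-hubVertex j)) (card-pair (suc n * toℕ j))) ⟨
    card (label (pathVertex i)) ⊔ card (label (hubVertex j)) ∎
    where open ≡-Reasoning

  label-weakIASI : IsWeakIASI (Fan m n) label
  label-weakIASI = record
    { iasi = record { nonempty = label-nonempty ; f-inj = label-injective ; f⁺-inj = edgeLabel-injective }
    ; weak = label-weak
    }

  monoEdges⊆pathEdges : monoEdges (Fan m n) label ⊆ tabulate pathEdge
  monoEdges⊆pathEdges e∈mono
    with e∈E , |e|≡1 ← ∈-filter⁻ (monoIndexed? (Fan m n) label) {xs = edges (Fan m n)} e∈mono
    with edgeKind e∈E
  ... | path k    = ∈-tabulate⁺ k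
  ... | spoke i j = contradiction (trans (sym (spokeEdge-card i j)) |e|≡1) λ ()

  label-monoEdgeCount≤n : monoEdgeCount (Fan m n) label ≤ n
  label-monoEdgeCount≤n = Unique-⊆-tabulate⇒length≤ pathEdge
    (Unique.filter⁺ (monoIndexed? (Fan m n) label) (edges-unique (Fan m n))) monoEdges⊆pathEdges

mainTheorem1 : ∀ (m n : ℕ) → 1 < m → 1 < n → IsSparingNumber (Fan m n) n
mainTheorem1 m n 1<m _ =
  (label , label-weakIASI , ≤-antisym label-monoEdgeCount≤n (sparing-lower-bound 1<m label-weakIASI)) ,
  λ _ → sparing-lower-bound 1<m
  where open Construction m n
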